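{- Let $S$ and $S'$ be composition series for the finite groups $G$ and $H$. Then there is a bijection between $\mathrm{Iso}(S, S')$ and $\mathrm{Iso}(X(S), X(S'))$.
   Context: All groups are finite and $n = |G|$. For a composition series $S$ given by $G_0 = 1 \triangleleft \cdots \triangleleft G_m = G$ and a composition series $S'$ given by $H_0 = 1 \triangleleft \cdots \triangleleft H_m = H$, $\mathrm{Iso}(S,S')$ is the set of isomorphisms $\phi : G \to H$ with $\phi[G_i] = H_i$ for all $i$. The tree $T(S)$ has nodes $\bigcup_i G/G_i$ (cosets), root $G$, leaves identified with the elements $x \in G$, and an edge from each $xG_{i+1}$ to each $yG_i \subseteq xG_{i+1}$. The colored graph $X(S)$ is built as follows: take a copy $T_S$ of $T(S)$, and for each $x \in G$ a copy $T_S^{(x)}$ of $T(S)$ whose root is identified with the leaf $x$ of $T_S$; the leaf for $y$ in $T_S^{(x)}$ is denoted $y^{(x)}$. For each $x, y \in G$ attach three new leaves $y_\leftarrow^{(x)}, y_\rightarrow^{(x)}, y_=^{(x)}$ to $y^{(x)}$. For all $x,y,z \in G$ with $xy = z$, add an edge from $y_\leftarrow^{(x)}$ to $x_\rightarrow^{(y)}$ and from $x_\rightarrow^{(y)}$ to $y_=^{(z)}$, coloring $y_\leftarrow^{(x)}$ "left", $x_\rightarrow^{(y)}$ "right", $y_=^{(z)}$ "equal". The root of $T_S$ is colored "root" and all remaining nodes "internal". $\mathrm{Iso}(X(S), X(S'))$ denotes the set of color-preserving graph isomorphisms from $X(S)$ to $X(S')$. -}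

module Defs where

open import Level using (0ℓ)
open import Data.Nat as ℕ using (ℕ; zero; suc)
open import Data.Fin as Fin using (Fin; toℕ; fromℕ; inject₁)
open import Data.Fin.Subset using (Subset; _∈_; _⊆_; ⁅_⁆; ⊤)
open import Data.Product using (Σ; ∃; _×_; _,_; proj₁; proj₂)
open import Data.Sum using (_⊎_)
open import Data.Empty using (⊥)
open import Data.Bool using (if_then_else_)
open import Relation.Nullary using (¬_; does)
open import Relation.Binary.PropositionalEquality using (_≡_; refl; sym; trans)
open import Relation.Binary.Bundles using (Setoid)
open import Algebra.Structures using (IsGroup)
open import Function.Definitions using (Bijective)

-- Finite groups: carrier Fin n (every finite group is isomorphic to one
-- of this form), with propositional equality.

record FinGroup : Set where
  field
    n       : ℕ
    _·_     : Fin n → Fin n → Fin n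
    e       : Fin n
    _⁻¹     : Fin n → Fin n
    isGroup : IsGroup _≡_ _·_ e _⁻¹
  infixl 7 _·_
  infix 8 _⁻¹

module _ (G : FinGroup) where
  open FinGroup G

  record IsSubgroup (A : Subset n) : Set where
    field
      e∈  : e ∈ A
      ·∈  : ∀ {x y} → x ∈ A → y ∈ A → (x · y) ∈ A
      ⁻¹∈ : ∀ {x} → x ∈ A → (x ⁻¹) ∈ A

  IsNormalIn : Subset n → Subset n → Set
  IsNormalIn A B =
    IsSubgroup A × A ⊆ B × (∀ {a b} → a ∈ A → b ∈ B → (b · a · b ⁻¹) ∈ A)

  -- A ◁ B with B/A simple, i.e. A is a maximal proper normal subgroup of B
  IsMaximalNormalIn : Subset n → Subset n → Set
  IsMaximalNormalIn A B =
    IsNormalIn A B × ¬ (B ⊆ A) ×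
    (∀ N → IsNormalIn N B → A ⊆ N → N ⊆ A ⊎ B ⊆ N)

record CompositionSeries (G : FinGroup) (m : ℕ) : Set where
  open FinGroup G
  field
    grp      : Fin (suc m) → Subset n
    subgroup : ∀ i → IsSubgroup G (grp i)
    bottom   : grp Fin.zero ≡ ⁅ e ⁆
    whole    : grp (fromℕ m) ≡ ⊤
    maximal  : ∀ (i : Fin m) → IsMaximalNormalIn G (grp (inject₁ i)) (grp (Fin.suc i))

record GroupIso (G H : FinGroup) : Set where
  private
    module G = FinGroup G
    module H = FinGroup H
  field
    fun : Fin G.n → Fin H.n
    hom : ∀ x y → fun (x G.· y) ≡ fun x H.· fun y
    bij : Bijective _≡_ _≡_ fun

record SeriesIso {G H : FinGroup} {m : ℕ}
                 (S : CompositionSeries G m) (S' : CompositionSeries H m) : Set where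
  private
    module S  = CompositionSeries S
    module S' = CompositionSeries S'
  field
    iso : GroupIso G H
  open GroupIso iso
  field
    image⊆ : ∀ i x → x ∈ S.grp i → fun x ∈ S'.grp i
    image⊇ : ∀ i y → y ∈ S'.grp i → ∃ λ x → x ∈ S.grp i × fun x ≡ y

data Dir : Set where
  left right equal : Dir

data Color : Set where
  cLeft cRight cEqual cRoot cInternal : Color

module X {G : FinGroup} {m : ℕ} (S : CompositionSeries G m) where
  open FinGroup G
  open CompositionSeries S

  IsCoset : Fin (suc m) → Subset n → Set
  IsCoset i C = ∃ λ x → ∀ y →
    (y ∈ C → (x ⁻¹ · y) ∈ grp i) × ((x ⁻¹ · y) ∈ grp i → y ∈ C)

  -- nodes of T(S): cosets in G/Gᵢ (tagged with i)
  record Node : Set where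
    constructor node
    field
      lvl     : Fin (suc m)
      set     : Subset n
      .coset  : IsCoset lvl set

  -- non-root nodes of T(S) (cosets in G/Gᵢ with i < m)
  record SubNode : Set where
    constructor subnode
    field
      lvl     : Fin m
      set     : Subset n
      .coset  : IsCoset (inject₁ lvl) set

  -- vertices of X(S): nodes of T_S; non-root nodes of the copies T_S^(x)
  -- (the root of T_S^(x) is the leaf x of T_S); the extra leaves y_d^(x)
  data Vtx : Set where
    tv : Node → Vtx
    cv : (x : Fin n) → SubNode → Vtx
    ev : (x y : Fin n) → Dir → Vtx      -- ev x y d = y_d^(x)

  -- directed edge relation (the graph is undirected, see Adj)
  Edge : Vtx → Vtx → Set
  Edge (tv a) (tv b) =
    toℕ (Node.lvl a) ≡ suc (toℕ (Node.lvl b)) × Node.set b ⊆ Node.set a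
  -- leaf x of T_S (= root of T_S^(x)) to the children of that root
  Edge (tv a) (cv x b) =
    toℕ (Node.lvl a) ≡ 0 × Node.set a ≡ ⁅ x ⁆ × suc (toℕ (SubNode.lvl b)) ≡ m
  Edge (cv x a) (cv x' b) =
    x ≡ x' × toℕ (SubNode.lvl a) ≡ suc (toℕ (SubNode.lvl b)) ×
    SubNode.set b ⊆ SubNode.set a
  -- leaf y^(x) to the new leaves y_d^(x)   (case m > 0)
  Edge (cv x a) (ev x' y d) =
    x ≡ x' × toℕ (SubNode.lvl a) ≡ 0 × SubNode.set a ≡ ⁅ y ⁆
  -- leaf y^(x) to the new leaves y_d^(x)   (case m = 0: y^(x) is the leaf x of T_S)
  Edge (tv a) (ev x y d) =
    m ≡ 0 × toℕ (Node.lvl a) ≡ 0 × Node.set a ≡ ⁅ x ⁆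
  -- y_←^(x) — x_→^(y)
  Edge (ev x y left) (ev y' x' right) = y' ≡ y × x' ≡ x
  -- x_→^(y) — y_=^(z)  with xy = z
  Edge (ev y x right) (ev z y' equal) = z ≡ x · y × y' ≡ y
  Edge _ _ = ⊥

  Adj : Vtx → Vtx → Set
  Adj u v = Edge u v ⊎ Edge v u

  color : Vtx → Color
  color (tv a)        = if does (Node.lvl a Fin.≟ fromℕ m) then cRoot else cInternal
  color (cv _ _)      = cInternal
  color (ev _ _ left)  = cLeft
  color (ev _ _ right) = cRight
  color (ev _ _ equal) = cEqual

record GraphIso {G H : FinGroup} {m : ℕ}
                (S : CompositionSeries G m) (S' : CompositionSeries H m) : Set where
  field
    fun : X.Vtx S → X.Vtx S'
    bij : Bijective _≡_ _≡_ fun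
    adj : ∀ u v → (X.Adj S u v → X.Adj S' (fun u) (fun v))
                × (X.Adj S' (fun u) (fun v) → X.Adj S u v)
    col : ∀ v → X.color S' (fun v) ≡ X.color S v

module _ {G H : FinGroup} {m : ℕ}
         (S : CompositionSeries G m) (S' : CompositionSeries H m) where

  IsoSeriesSetoid : Setoid 0ℓ 0ℓ
  IsoSeriesSetoid = record
    { Carrier = SeriesIso S S'
    ; _≈_ = λ φ ψ → ∀ x → GroupIso.fun (SeriesIso.iso φ) x ≡ GroupIso.fun (SeriesIso.iso ψ) x
    ; isEquivalence = record
      { refl = λ x → refl
      ; sym = λ p x → sym (p x)
      ; trans = λ p q x → trans (p x) (q x) } }

  IsoGraphSetoid : Setoid 0ℓ 0ℓ
  IsoGraphSetoid = record
    { Carrier = GraphIso S S'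
    ; _≈_ = λ f g → ∀ v → GraphIso.fun f v ≡ GraphIso.fun g v
    ; isEquivalence = record
      { refl = λ x → refl
      ; sym = λ p x → sym (p x)
      ; trans = λ p q x → trans (p x) (q x) } }

module Submission where

-- The "tree vertices" (nodes of T_S and of the copies
--    T_S^(x)) have a height and a set of leaves y^(x) lying below them.  Tree
--    edges, edges to the extra leaves y_d^(x), and tree vertices themselves are
--    characterised by heights and leaf sets alone.
--  * Series → graph.  A series isomorphism φ induces X(φ): cosets C go to φ[C]
--    and labels x to φ(x).  It preserves heights and leaf sets, hence edges.
--  * Graph → series.  A colour-preserving graph isomorphism f preserves heights
--    (induction on the height, using f⁻¹ to orient edges) and leaf sets, and
--    sends y_d^(x) to α(y)_d^(α(x)) for one map α.  The edges
--    y_←^(x) — x_→^(y) — (xy)_=^(y) make α a homomorphism, the nodes Gᵢ of T_S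
--    give α[Gᵢ] ⊆ Hᵢ, and the α of f⁻¹ inverts α.
--  * X(α) = f, since tree vertices are determined by height and leaves; and φ
--    is read off X(φ) at the vertices x_←^(x).

open import Defs
open import Level using (0ℓ)
open import Data.Nat as ℕ using (ℕ; zero; suc; _+_)
import Data.Nat.Properties as ℕP
open import Data.Fin as Fin using (Fin; toℕ; fromℕ; inject₁; fromℕ<)
import Data.Fin.Properties as FinP
open import Data.Fin.Subset using (Subset; _∈_; _⊆_; ⁅_⁆)
open import Data.Fin.Subset.Properties using (_∈?_; nonempty?; x∈⁅x⁆; x∈⁅y⁆⇒x≡y; ⊆-antisym; ∈⊤)
open import Data.Vec using (lookup; tabulate)
open import Data.Vec.Properties using (lookup∘tabulate; tabulate∘lookup; tabulate-cong; []=⇒lookup; lookup⇒[]=)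
open import Data.Product using (∃; _×_; _,_; proj₁; proj₂)
open import Data.Sum using (inj₁; inj₂)
open import Data.Empty using (⊥; ⊥-elim)
open import Data.Unit using (tt) renaming (⊤ to Unit)
open import Data.Bool using (true; false)
open import Relation.Nullary using (yes; no; does)
open import Relation.Nullary.Decidable using (recompute)
open import Relation.Binary.PropositionalEquality
open import Algebra.Structures using (IsGroup)
open import Algebra.Bundles using (Group)
import Algebra.Properties.Group as GroupProperties
open import Function.Base using (_∘_)
open import Function.Definitions using (Bijective)
open import Function.Consequences.Propositional
  using (inverseᵇ⇒bijective; strictlyInverseˡ⇒inverseˡ; strictlyInverseʳ⇒inverseʳ)
open import Function.Bundles using (Bijection)

record TwoSidedInverse {A B : Set} (f : A → B) : Set where
  field
    inv   : B → A
    f∘inv : ∀ y → f (inv y) ≡ y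
    inv∘f : ∀ x → inv (f x) ≡ x

bijective⇒inverse : ∀ {A B : Set} {f : A → B} → Bijective _≡_ _≡_ f → TwoSidedInverse f
bijective⇒inverse {f = f} (injective , surjective) = record
  { inv = λ y → proj₁ (surjective y)
  ; f∘inv = f∘inv
  ; inv∘f = λ x → injective (f∘inv (f x)) }
  where
    f∘inv : ∀ y → f (proj₁ (surjective y)) ≡ y
    f∘inv y = proj₂ (surjective y) refl

inverse⇒bijective : ∀ {A B : Set} {f : A → B} → TwoSidedInverse f → Bijective _≡_ _≡_ f
inverse⇒bijective {f = f} i =
  inverseᵇ⇒bijective (strictlyInverseˡ⇒inverseˡ f f∘inv , strictlyInverseʳ⇒inverseʳ f inv∘f)
  where open TwoSidedInverse i

-- used to rule out edges pointing the wrong way between levels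
n≢2+n : ∀ k → k ≡ suc (suc k) → ⊥
n≢2+n k = ℕP.<⇒≢ (ℕP.m<n⇒m<1+n (ℕP.n<1+n k))

-- Preimages of subsets of Fin k.  Both cosets y Gᵢ (preimage of Gᵢ under
-- z ↦ y⁻¹z) and images φ[C] (preimage of C under φ⁻¹) are of this form.

preimage : ∀ {k l} → (Fin k → Fin l) → Subset l → Subset k
preimage g C = tabulate (λ z → lookup C (g z))

∈-preimage⁺ : ∀ {k l} {g : Fin k → Fin l} {C : Subset l} {z} → g z ∈ C → z ∈ preimage g C
∈-preimage⁺ {g = g} {C} {z} gz∈C =
  lookup⇒[]= z _ (trans (lookup∘tabulate (λ z → lookup C (g z)) z) ([]=⇒lookup gz∈C))

∈-preimage⁻ : ∀ {k l} {g : Fin k → Fin l} {C : Subset l} {z} → z ∈ preimage g C → g z ∈ C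
∈-preimage⁻ {g = g} {C} {z} z∈ =
  lookup⇒[]= (g z) C (trans (sym (lookup∘tabulate (λ z → lookup C (g z)) z)) ([]=⇒lookup z∈))

preimage-cong : ∀ {k l} {g h : Fin k → Fin l} (C : Subset l) →
                (∀ z → g z ≡ h z) → preimage g C ≡ preimage h C
preimage-cong C g≗h = tabulate-cong (λ z → cong (lookup C) (g≗h z))

preimage-inverse : ∀ {k l} {g : Fin l → Fin k} {h : Fin k → Fin l} (C : Subset k) →
                   (∀ z → g (h z) ≡ z) → preimage h (preimage g C) ≡ C
preimage-inverse {g = g} {h} C g∘h≗id = begin
  preimage h (preimage g C)  ≡⟨ tabulate-cong (λ z → lookup∘tabulate _ (h z)) ⟩
  preimage (g ∘ h) C         ≡⟨ preimage-cong C g∘h≗id ⟩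
  tabulate (lookup C)        ≡⟨ tabulate∘lookup C ⟩
  C                          ∎
  where open ≡-Reasoning

module GroupFacts (G : FinGroup) where
  open FinGroup G public
  open IsGroup isGroup public using (assoc; identityˡ; inverseˡ; inverseʳ)

  asGroup : Group 0ℓ 0ℓ
  asGroup = record
    { Carrier = Fin n ; _≈_ = _≡_ ; _∙_ = _·_ ; ε = e ; _⁻¹ = _⁻¹ ; isGroup = isGroup }

  open GroupProperties asGroup public
    using (⁻¹-involutive; ⁻¹-anti-homo-∙; ⁻¹-injective; ε⁻¹≈ε;
           inverseˡ-unique; inverseʳ-unique; identityˡ-unique; \\-leftDividesˡ)

  div≡e⇒≡ : ∀ a b → a ⁻¹ · b ≡ e → a ≡ b
  div≡e⇒≡ a b eq = ⁻¹-injective (inverseˡ-unique (a ⁻¹) b eq)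

  div-trans : ∀ c a b → (c ⁻¹ · a) · (a ⁻¹ · b) ≡ c ⁻¹ · b
  div-trans c a b = begin
    (c ⁻¹ · a) · (a ⁻¹ · b)   ≡⟨ assoc _ _ _ ⟩
    c ⁻¹ · (a · (a ⁻¹ · b))   ≡⟨ cong (c ⁻¹ ·_) (\\-leftDividesˡ a b) ⟩
    c ⁻¹ · b                  ∎
    where open ≡-Reasoning

  div-inv : ∀ c a → (c ⁻¹ · a) ⁻¹ ≡ a ⁻¹ · c
  div-inv c a = trans (⁻¹-anti-homo-∙ (c ⁻¹) a) (cong (a ⁻¹ ·_) (⁻¹-involutive c))

  e-div : ∀ z → e ⁻¹ · z ≡ z
  e-div z = trans (cong (_· z) ε⁻¹≈ε) (identityˡ z)

  -- For a subgroup A, "a⁻¹b ∈ A" says that a and b lie in the same left coset.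
  module SameLeftCoset {A : Subset n} (sg : IsSubgroup G A) where
    open IsSubgroup sg

    refl∈ : ∀ a → (a ⁻¹ · a) ∈ A
    refl∈ a = subst (_∈ A) (sym (inverseˡ a)) e∈

    trans∈ : ∀ {c a b} → (c ⁻¹ · a) ∈ A → (a ⁻¹ · b) ∈ A → (c ⁻¹ · b) ∈ A
    trans∈ {c} {a} {b} p q = subst (_∈ A) (div-trans c a b) (·∈ p q)

    euclid∈ : ∀ {c a b} → (c ⁻¹ · a) ∈ A → (c ⁻¹ · b) ∈ A → (a ⁻¹ · b) ∈ A
    euclid∈ {c} {a} {b} p q =
      subst (_∈ A) (trans (cong (_· (c ⁻¹ · b)) (div-inv c a)) (div-trans a c b)) (·∈ (⁻¹∈ p) q)

    transport∈ : ∀ {a b} → a ∈ A → (a ⁻¹ · b) ∈ A → b ∈ A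
    transport∈ {a} {b} a∈ ab∈ = subst (_∈ A) (\\-leftDividesˡ a b) (·∈ a∈ ab∈)

module HomomorphismFacts {G H : FinGroup} (f : Fin (FinGroup.n G) → Fin (FinGroup.n H))
         (hom : ∀ x y → f (FinGroup._·_ G x y) ≡ FinGroup._·_ H (f x) (f y)) where
  private
    module G = GroupFacts G
    module H = GroupFacts H

  f-e : f G.e ≡ H.e
  f-e = H.identityˡ-unique (f G.e) (f G.e) (trans (sym (hom G.e G.e)) (cong f (G.identityˡ G.e)))

  f-inv : ∀ x → f (x G.⁻¹) ≡ f x H.⁻¹
  f-inv x = H.inverseʳ-unique (f x) (f (x G.⁻¹))
    (trans (sym (hom x (x G.⁻¹))) (trans (cong f (G.inverseʳ x)) f-e))

  inverse-hom : (i : TwoSidedInverse f) → let open TwoSidedInverse i in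
                ∀ a b → inv (a H.· b) ≡ inv a G.· inv b
  inverse-hom i a b = begin
    inv (a H.· b)                  ≡⟨ cong inv (sym (cong₂ H._·_ (f∘inv a) (f∘inv b))) ⟩
    inv (f (inv a) H.· f (inv b))  ≡⟨ cong inv (sym (hom (inv a) (inv b))) ⟩
    inv (f (inv a G.· inv b))      ≡⟨ inv∘f _ ⟩
    inv a G.· inv b                ∎
    where
      open TwoSidedInverse i
      open ≡-Reasoning

dirColour : Dir → Color
dirColour left  = cLeft
dirColour right = cRight
dirColour equal = cEqual

IsTreeColour : Color → Set
IsTreeColour cRoot     = Unit
IsTreeColour cInternal = Unit
IsTreeColour _         = ⊥

dirColour-not-tree : ∀ d → IsTreeColour (dirColour d) → ⊥
dirColour-not-tree left  ()
dirColour-not-tree right ()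
dirColour-not-tree equal ()

module Geometry {G : FinGroup} {m : ℕ} (S : CompositionSeries G m) where
  open GroupFacts G
  open CompositionSeries S
  open X S
  private module Same i = SameLeftCoset (subgroup i)

  coset : Fin (suc m) → Fin n → Subset n
  coset i y = preimage (y ⁻¹ ·_) (grp i)

  coset-isCoset : ∀ i y → IsCoset i (coset i y)
  coset-isCoset i y = y , λ z → ∈-preimage⁻ , ∈-preimage⁺

  ∈-coset : ∀ i y → y ∈ coset i y
  ∈-coset i y = ∈-preimage⁺ (Same.refl∈ i y)

  -- Facts about an arbitrary coset C of Gᵢ.  The evidence that C is a coset is
  -- irrelevant in X(S), so each conclusion is recomputed by a decision procedure.
  coset-nonempty : ∀ i C → .(IsCoset i C) → ∃ λ z → z ∈ C
  coset-nonempty i C p =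
    recompute (nonempty? C) (proj₁ p , proj₂ (proj₂ p (proj₁ p)) (Same.refl∈ i (proj₁ p)))

  coset-related : ∀ i C → .(IsCoset i C) → ∀ {a b} → a ∈ C → b ∈ C → (a ⁻¹ · b) ∈ grp i
  coset-related i C p {a} {b} a∈ b∈ = recompute ((a ⁻¹ · b) ∈? grp i)
    (Same.euclid∈ i (proj₁ (proj₂ p a) a∈) (proj₁ (proj₂ p b) b∈))

  coset-closed : ∀ i C → .(IsCoset i C) → ∀ {a b} → a ∈ C → (a ⁻¹ · b) ∈ grp i → b ∈ C
  coset-closed i C p {a} {b} a∈ ab∈ = recompute (b ∈? C)
    (proj₂ (proj₂ p b) (Same.trans∈ i (proj₁ (proj₂ p a) a∈) ab∈))

  coset-in-grp : ∀ i C → .(IsCoset i C) → ∀ {a b} → a ∈ C → b ∈ C → a ∈ grp i → b ∈ grp i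
  coset-in-grp i C p a∈ b∈ a∈G = Same.transport∈ i a∈G (coset-related i C p a∈ b∈)

  grp₀-trivial : ∀ i → toℕ i ≡ 0 → ∀ {x} → x ∈ grp i → x ≡ e
  grp₀-trivial i i≡0 {x} x∈ =
    x∈⁅y⁆⇒x≡y e (subst (x ∈_) (trans (cong grp (FinP.toℕ-injective i≡0)) bottom) x∈)

  coset₀-unique : ∀ i C → toℕ i ≡ 0 → .(IsCoset i C) → ∀ {a b} → a ∈ C → b ∈ C → a ≡ b
  coset₀-unique i C i≡0 p a∈ b∈ = div≡e⇒≡ _ _ (grp₀-trivial i i≡0 (coset-related i C p a∈ b∈))

  coset₀-singleton : ∀ i C → toℕ i ≡ 0 → .(IsCoset i C) → ∀ {a} → a ∈ C → C ≡ ⁅ a ⁆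
  coset₀-singleton i C i≡0 p {a} a∈ = ⊆-antisym
    (λ {z} z∈ → subst (_∈ ⁅ a ⁆) (coset₀-unique i C i≡0 p a∈ z∈) (x∈⁅x⁆ a))
    (λ {z} z∈ → subst (_∈ C) (sym (x∈⁅y⁆⇒x≡y a z∈)) a∈)

  length₀-trivial : m ≡ 0 → ∀ b → b ≡ e
  length₀-trivial m≡0 b =
    grp₀-trivial (fromℕ m) (trans (FinP.toℕ-fromℕ m) m≡0) (subst (b ∈_) (sym whole) ∈⊤)

  grp-step : ∀ (k : Fin m) (j : Fin (suc m)) → toℕ j ≡ suc (toℕ k) → grp (inject₁ k) ⊆ grp j
  grp-step k j j≡k+1 x∈ = subst (λ t → _ ∈ grp t) (FinP.toℕ-injective (sym j≡k+1))
    (proj₁ (proj₂ (proj₁ (maximal k))) x∈)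

  coset-step : ∀ (k : Fin m) (j : Fin (suc m)) → toℕ j ≡ suc (toℕ k) →
               ∀ C → .(IsCoset j C) → ∀ {y} → y ∈ C → coset (inject₁ k) y ⊆ C
  coset-step k j j≡k+1 C p y∈ z∈ = coset-closed j C p y∈ (grp-step k j j≡k+1 (∈-preimage⁻ z∈))

  IsTree : Vtx → Set
  IsTree (tv _)     = Unit
  IsTree (cv _ _)   = Unit
  IsTree (ev _ _ _) = ⊥

  -- Height above the leaves y^(x): m + i for xGᵢ in T_S, i for xGᵢ in a copy.
  height : Vtx → ℕ
  height (tv a)     = m + toℕ (Node.lvl a)
  height (cv _ a)   = toℕ (SubNode.lvl a)
  height (ev _ _ _) = 0

  -- Below w x y: the leaf y^(x) lies below the tree vertex w.
  Below : Vtx → Fin n → Fin n → Set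
  Below (tv a)     x y = x ∈ Node.set a
  Below (cv x' a)  x y = x ≡ x' × y ∈ SubNode.set a
  Below (ev _ _ _) x y = ⊥

  evCopy evLeaf : Vtx → Fin n
  evCopy (ev x _ _) = x
  evCopy _          = e
  evLeaf (ev _ y _) = y
  evLeaf _          = e

  -- nodes of T_S have height ≥ m, nodes of the copies height < m
  copy-below-m : ∀ {k t} → m + k ≡ t → t ℕ.< m → ⊥
  copy-below-m {k} m+k≡t t<m = ℕP.<⇒≱ t<m (subst (m ℕ.≤_) m+k≡t (ℕP.m≤m+n m k))

  tv-cong : ∀ {i j C D} → i ≡ j → C ≡ D → .(p : IsCoset i C) → .(q : IsCoset j D) →
            tv (node i C p) ≡ tv (node j D q)
  tv-cong refl refl p q = refl

  cv-cong : ∀ {x x' i j C D} → x ≡ x' → i ≡ j → C ≡ D →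
            .(p : IsCoset (inject₁ i) C) → .(q : IsCoset (inject₁ j) D) →
            cv x (subnode i C p) ≡ cv x' (subnode j D q)
  cv-cong refl refl refl p q = refl

  treeEdge⇒ : ∀ w u → IsTree w → IsTree u → Edge w u →
              height w ≡ suc (height u) × (∀ x y → Below u x y → Below w x y)
  treeEdge⇒ (tv (node i C p)) (tv (node j D q)) _ _ (i≡j+1 , D⊆C) =
    trans (cong (m +_) i≡j+1) (ℕP.+-suc m _) , λ x y x∈ → D⊆C x∈
  treeEdge⇒ (tv (node i C p)) (cv x (subnode j D q)) _ _ (i≡0 , C≡x , j+1≡m) =
    trans (cong (m +_) i≡0) (trans (ℕP.+-identityʳ m) (sym j+1≡m)) ,
    λ x' y (x'≡x , _) → subst (x' ∈_) (sym C≡x) (subst (_∈ ⁅ x ⁆) (sym x'≡x) (x∈⁅x⁆ x))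
  treeEdge⇒ (cv x (subnode i C p)) (cv x' (subnode j D q)) _ _ (x≡x' , i≡j+1 , D⊆C) =
    i≡j+1 , λ a b (a≡x' , b∈) → trans a≡x' (sym x≡x') , D⊆C b∈

  treeEdge⇐ : ∀ w u → IsTree w → IsTree u → height w ≡ suc (height u) →
              (∀ x y → Below u x y → Below w x y) → Edge w u
  treeEdge⇐ (tv (node i C p)) (tv (node j D q)) _ _ hw≡hu+1 D⊆C =
    ℕP.+-cancelˡ-≡ m _ _ (trans hw≡hu+1 (sym (ℕP.+-suc m _))) , λ {z} z∈ → D⊆C z e z∈
  treeEdge⇐ (tv (node Fin.zero C p)) (cv x (subnode j D q)) _ _ hw≡hu+1 D⊆C =
    refl , coset₀-singleton Fin.zero C refl p (D⊆C x z (refl , z∈D)) ,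
    sym (trans (sym (ℕP.+-identityʳ m)) hw≡hu+1)
    where
      z = proj₁ (coset-nonempty (inject₁ j) D q)
      z∈D = proj₂ (coset-nonempty (inject₁ j) D q)
  treeEdge⇐ (tv (node (Fin.suc i) C p)) (cv x (subnode j D q)) _ _ hw≡hu+1 _ =
    ⊥-elim (copy-below-m (ℕP.suc-injective (trans (sym (ℕP.+-suc m _)) hw≡hu+1)) (FinP.toℕ<n j))
  treeEdge⇐ (cv x (subnode i C p)) (tv (node j D q)) _ _ hw≡hu+1 _ =
    ⊥-elim (copy-below-m (trans (ℕP.+-suc m _) (sym hw≡hu+1)) (FinP.toℕ<n i))
  treeEdge⇐ (cv x (subnode i C p)) (cv x' (subnode j D q)) _ _ hw≡hu+1 D⊆C =
    sym (proj₁ (D⊆C x' z (refl , z∈D))) , hw≡hu+1 , λ {y} y∈ → proj₂ (D⊆C x' y (refl , y∈))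
    where
      z = proj₁ (coset-nonempty (inject₁ j) D q)
      z∈D = proj₂ (coset-nonempty (inject₁ j) D q)

  extraEdge⇒ : ∀ w {x y d} → IsTree w → Edge w (ev x y d) → height w ≡ 0 × Below w x y
  extraEdge⇒ (tv (node i C p)) {x} _ (m≡0 , i≡0 , C≡x) =
    cong₂ _+_ m≡0 i≡0 , subst (x ∈_) (sym C≡x) (x∈⁅x⁆ x)
  extraEdge⇒ (cv x' (subnode i C p)) {x} {y} _ (x'≡x , i≡0 , C≡y) =
    i≡0 , sym x'≡x , subst (y ∈_) (sym C≡y) (x∈⁅x⁆ y)

  extraEdge⇐ : ∀ w {x y d} → IsTree w → height w ≡ 0 → Below w x y → Edge w (ev x y d)
  extraEdge⇐ (tv (node i C p)) _ hw≡0 x∈ =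
    ℕP.m+n≡0⇒m≡0 m hw≡0 , ℕP.m+n≡0⇒n≡0 m hw≡0 , coset₀-singleton i C (ℕP.m+n≡0⇒n≡0 m hw≡0) p x∈
  extraEdge⇐ (cv x' (subnode i C p)) _ hw≡0 (x≡x' , y∈) =
    sym x≡x' , hw≡0 , coset₀-singleton (inject₁ i) C (trans (FinP.toℕ-inject₁ i) hw≡0) p y∈

  tree-ext : ∀ w w' → IsTree w → IsTree w' → height w ≡ height w' →
             (∀ x y → Below w x y → Below w' x y) → (∀ x y → Below w' x y → Below w x y) → w ≡ w'
  tree-ext (tv (node i C p)) (tv (node j D q)) _ _ hw≡hw' C⊆D D⊆C =
    tv-cong (FinP.toℕ-injective (ℕP.+-cancelˡ-≡ m _ _ hw≡hw'))
            (⊆-antisym (λ {z} z∈ → C⊆D z e z∈) (λ {z} z∈ → D⊆C z e z∈)) p q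
  tree-ext (tv (node i C p)) (cv x (subnode j D q)) _ _ hw≡hw' _ _ =
    ⊥-elim (copy-below-m hw≡hw' (FinP.toℕ<n j))
  tree-ext (cv x (subnode i C p)) (tv (node j D q)) _ _ hw≡hw' _ _ =
    ⊥-elim (copy-below-m (sym hw≡hw') (FinP.toℕ<n i))
  tree-ext (cv x (subnode i C p)) (cv x' (subnode j D q)) _ _ hw≡hw' C⊆D D⊆C =
    cv-cong (proj₁ (C⊆D x z (refl , z∈C))) (FinP.toℕ-injective hw≡hw')
            (⊆-antisym (λ {y} y∈ → proj₂ (C⊆D x y (refl , y∈))) (λ {y} y∈ → proj₂ (D⊆C x' y (refl , y∈)))) p q
    where
      z = proj₁ (coset-nonempty (inject₁ i) C p)
      z∈C = proj₂ (coset-nonempty (inject₁ i) C p)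

  -- Above every leaf below a tree vertex of positive height there is a child:
  -- the coset of the next smaller group containing that leaf.
  child : ∀ w {h x y} → IsTree w → height w ≡ suc h → Below w x y →
          ∃ λ u → IsTree u × Edge w u × Below u x y
  child (tv (node Fin.zero C p)) {h} {x} {y} _ hw≡h+1 x∈ =
    cv x (subnode k (coset (inject₁ k) y) (coset-isCoset (inject₁ k) y)) , tt ,
    (refl , coset₀-singleton Fin.zero C refl p x∈ , trans (cong suc (FinP.toℕ-fromℕ< h<m)) (sym m≡h+1)) ,
    refl , ∈-coset (inject₁ k) y
    where
      m≡h+1 : m ≡ suc h
      m≡h+1 = trans (sym (ℕP.+-identityʳ m)) hw≡h+1
      h<m : h ℕ.< m
      h<m = subst (h ℕ.<_) (sym m≡h+1) (ℕP.n<1+n h)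
      k : Fin m
      k = fromℕ< h<m
  child (tv (node (Fin.suc k) C p)) {h} {x} {y} _ _ x∈ =
    tv (node (inject₁ k) (coset (inject₁ k) x) (coset-isCoset (inject₁ k) x)) , tt ,
    (cong suc (sym (FinP.toℕ-inject₁ k)) , coset-step k (Fin.suc k) refl C p x∈) ,
    ∈-coset (inject₁ k) x
  child (cv x' (subnode i C p)) {h} {x} {y} _ i≡h+1 (x≡x' , y∈) =
    cv x' (subnode k (coset (inject₁ k) y) (coset-isCoset (inject₁ k) y)) , tt ,
    (refl , i≡k+1 , coset-step k (inject₁ i) (trans (FinP.toℕ-inject₁ i) i≡k+1) C p y∈) ,
    x≡x' , ∈-coset (inject₁ k) y
    where
      h<m : h ℕ.< m
      h<m = ℕP.<-trans (ℕP.n<1+n h) (subst (ℕ._< m) i≡h+1 (FinP.toℕ<n i))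
      k : Fin m
      k = fromℕ< h<m
      i≡k+1 : toℕ i ≡ suc (toℕ k)
      i≡k+1 = trans i≡h+1 (cong suc (sym (FinP.toℕ-fromℕ< h<m)))

  below-nonempty : ∀ w → IsTree w → ∃ λ x → ∃ λ y → Below w x y
  below-nonempty (tv (node i C p)) _ = proj₁ (coset-nonempty i C p) , e , proj₂ (coset-nonempty i C p)
  below-nonempty (cv x (subnode i C p)) _ =
    x , proj₁ (coset-nonempty (inject₁ i) C p) , refl , proj₂ (coset-nonempty (inject₁ i) C p)

  leaf : ∀ x y → ∃ λ w → IsTree w × height w ≡ 0 × Below w x y
  leaf x y with m ℕP.≟ 0
  ... | yes m≡0 = tv (node Fin.zero (coset Fin.zero x) (coset-isCoset Fin.zero x)) , tt ,
                  trans (ℕP.+-identityʳ m) m≡0 , ∈-coset Fin.zero x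
  ... | no m≢0 = cv x (subnode k (coset (inject₁ k) y) (coset-isCoset (inject₁ k) y)) , tt ,
                 FinP.toℕ-fromℕ< _ , refl , ∈-coset (inject₁ k) y
    where k = fromℕ< (ℕP.n≢0⇒n>0 m≢0)

  below₀-unique : ∀ w → IsTree w → height w ≡ 0 → ∀ {x y x' y'} →
                  Below w x y → Below w x' y' → x ≡ x' × y ≡ y'
  below₀-unique (tv (node i C p)) _ hw≡0 {y = y} {y' = y'} x∈ x'∈ =
    coset₀-unique i C (ℕP.m+n≡0⇒n≡0 m hw≡0) p x∈ x'∈ ,
    trans (length₀-trivial m≡0 y) (sym (length₀-trivial m≡0 y'))
    where m≡0 = ℕP.m+n≡0⇒m≡0 m hw≡0
  below₀-unique (cv x (subnode i C p)) _ hw≡0 (x₁≡x , y∈) (x₂≡x , y'∈) =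
    trans x₁≡x (sym x₂≡x) , coset₀-unique (inject₁ i) C (trans (FinP.toℕ-inject₁ i) hw≡0) p y∈ y'∈

  belowₘ-copy : ∀ w → IsTree w → height w ≡ m → ∀ {x y x' y'} →
                Below w x y → Below w x' y' → x ≡ x'
  belowₘ-copy (tv (node i C p)) _ hw≡m x∈ x'∈ =
    coset₀-unique i C (ℕP.+-cancelˡ-≡ m _ _ (trans hw≡m (sym (ℕP.+-identityʳ m)))) p x∈ x'∈
  belowₘ-copy (cv x (subnode i C p)) _ hw≡m _ _ =
    ⊥-elim (copy-below-m (trans (ℕP.+-identityʳ m) (sym hw≡m)) (FinP.toℕ<n i))

  below-grp : ∀ w (i : Fin (suc m)) → IsTree w → height w ≡ m + toℕ i → ∀ {x y x' y'} →
              Below w x y → Below w x' y' → x ∈ grp i → x' ∈ grp i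
  below-grp (tv (node j C p)) i _ hw≡m+i {x} {x' = x'} x∈ x'∈ x∈G =
    subst (λ t → x' ∈ grp t) j≡i (coset-in-grp j C p x∈ x'∈ (subst (λ t → x ∈ grp t) (sym j≡i) x∈G))
    where j≡i = FinP.toℕ-injective (ℕP.+-cancelˡ-≡ m _ _ hw≡m+i)
  below-grp (cv x (subnode j C p)) i _ hw≡m+i _ _ _ =
    ⊥-elim (copy-below-m (sym hw≡m+i) (FinP.toℕ<n j))

  extraAdj⇒edge : ∀ w → IsTree w → ∀ {x y d} → Adj w (ev x y d) → Edge w (ev x y d)
  extraAdj⇒edge w _ (inj₁ E) = E
  extraAdj⇒edge (tv _) _ {d = left}  (inj₂ ())
  extraAdj⇒edge (tv _) _ {d = right} (inj₂ ())
  extraAdj⇒edge (tv _) _ {d = equal} (inj₂ ())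
  extraAdj⇒edge (cv _ _) _ {d = left}  (inj₂ ())
  extraAdj⇒edge (cv _ _) _ {d = right} (inj₂ ())
  extraAdj⇒edge (cv _ _) _ {d = equal} (inj₂ ())

  treeAdj⇒edge : ∀ w u → IsTree w → IsTree u → Adj w u → height w ≡ suc (height u) → Edge w u
  treeAdj⇒edge w u _ _ (inj₁ E) _ = E
  treeAdj⇒edge w u tw tu (inj₂ E) hw≡hu+1 =
    ⊥-elim (n≢2+n (height u) (trans (proj₁ (treeEdge⇒ u w tu tw E)) (cong suc hw≡hu+1)))

  tree-colour : ∀ w → IsTree w → IsTreeColour (color w)
  tree-colour (tv (node i C p)) _ with does (i Fin.≟ fromℕ m)
  ... | true  = tt
  ... | false = tt
  tree-colour (cv _ _) _ = tt

  colour-tree : ∀ w → IsTreeColour (color w) → IsTree w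
  colour-tree (tv _)   _ = tt
  colour-tree (cv _ _) _ = tt
  colour-tree (ev _ _ left)  ()
  colour-tree (ev _ _ right) ()
  colour-tree (ev _ _ equal) ()

  extra-shape : ∀ w d → color w ≡ dirColour d → w ≡ ev (evCopy w) (evLeaf w) d
  extra-shape (tv a) d eq = ⊥-elim (dirColour-not-tree d (subst IsTreeColour eq (tree-colour (tv a) tt)))
  extra-shape (cv x a) d eq = ⊥-elim (dirColour-not-tree d (subst IsTreeColour eq (tree-colour (cv x a) tt)))
  extra-shape (ev x y left)  left  _ = refl
  extra-shape (ev x y right) right _ = refl
  extra-shape (ev x y equal) equal _ = refl
  extra-shape (ev x y left)  right ()
  extra-shape (ev x y left)  equal ()
  extra-shape (ev x y right) left  ()
  extra-shape (ev x y right) equal ()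
  extra-shape (ev x y equal) left  ()
  extra-shape (ev x y equal) right ()

  extra-colour : ∀ x y d → color (ev x y d) ≡ dirColour d
  extra-colour x y left  = refl
  extra-colour x y right = refl
  extra-colour x y equal = refl

-- An isomorphism G ≅ H mapping S onto S', together with its inverse; this
-- presentation is symmetric, so it can be inverted without further proof.
record InvertibleSeriesIso {G H : FinGroup} {m : ℕ}
         (S : CompositionSeries G m) (S' : CompositionSeries H m) : Set where
  field
    to          : Fin (FinGroup.n G) → Fin (FinGroup.n H)
    from        : Fin (FinGroup.n H) → Fin (FinGroup.n G)
    to∘from     : ∀ y → to (from y) ≡ y
    from∘to     : ∀ x → from (to x) ≡ x
    to-hom      : ∀ x y → to (FinGroup._·_ G x y) ≡ FinGroup._·_ H (to x) (to y)
    to-series   : ∀ i x → x ∈ CompositionSeries.grp S i → to x ∈ CompositionSeries.grp S' i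
    from-series : ∀ i y → y ∈ CompositionSeries.grp S' i → from y ∈ CompositionSeries.grp S i

  toInverse : TwoSidedInverse to
  toInverse = record { inv = from ; f∘inv = to∘from ; inv∘f = from∘to }

module _ {G H : FinGroup} {m : ℕ} {S : CompositionSeries G m} {S' : CompositionSeries H m} where

  invert : InvertibleSeriesIso S S' → InvertibleSeriesIso S' S
  invert σ = record
    { to = from ; from = to ; to∘from = from∘to ; from∘to = to∘from
    ; to-hom = HomomorphismFacts.inverse-hom {G} {H} to to-hom toInverse
    ; to-series = from-series ; from-series = to-series }
    where open InvertibleSeriesIso σ

  -- Every element of Iso(S, S') has an inverse; φ⁻¹[Hᵢ] ⊆ Gᵢ as φ[Gᵢ] ⊇ Hᵢ.
  withInverse : SeriesIso S S' → InvertibleSeriesIso S S'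
  withInverse φ = record
    { to = fun ; from = inv ; to∘from = f∘inv ; from∘to = inv∘f
    ; to-hom = hom ; to-series = image⊆ ; from-series = from-series }
    where
      open SeriesIso φ
      open GroupIso iso
      open TwoSidedInverse (bijective⇒inverse bij)
      from-series : ∀ i y → y ∈ CompositionSeries.grp S' i → inv y ∈ CompositionSeries.grp S i
      from-series i y y∈ with image⊇ i y y∈
      ... | x , x∈ , fx≡y = subst (_∈ CompositionSeries.grp S i) (trans (sym (inv∘f x)) (cong inv fx≡y)) x∈

  forgetInverse : InvertibleSeriesIso S S' → SeriesIso S S'
  forgetInverse σ = record
    { iso = record { fun = to ; hom = to-hom ; bij = inverse⇒bijective toInverse }
    ; image⊆ = to-series
    ; image⊇ = λ i y y∈ → from y , from-series i y y∈ , to∘from y }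
    where open InvertibleSeriesIso σ

module Induced {G H : FinGroup} {m : ℕ} {S : CompositionSeries G m} {S' : CompositionSeries H m}
               (σ : InvertibleSeriesIso S S') where
  open InvertibleSeriesIso σ
  private
    module G = GroupFacts G
    module H = GroupFacts H
    module CS = CompositionSeries S
    module CS' = CompositionSeries S'
    module XS = X S
    module XS' = X S'
    module T = Geometry S
    module T' = Geometry S'
  open HomomorphismFacts {G} {H} to to-hom using (f-inv)

  image : Subset G.n → Subset H.n
  image = preimage from

  image-coset : ∀ i C → XS.IsCoset i C → XS'.IsCoset i (image C)
  image-coset i C (c , c-rep) = to c , λ y →
      (λ y∈ → subst (_∈ CS'.grp i) (to-div y) (to-series i _ (proj₁ (c-rep (from y)) (∈-preimage⁻ y∈)))) ,
      (λ cy∈ → ∈-preimage⁺ (proj₂ (c-rep (from y)) (subst (_∈ CS.grp i) (from-div y) (from-series i _ cy∈))))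
    where
      to-div : ∀ y → to (c G.⁻¹ G.· from y) ≡ to c H.⁻¹ H.· y
      to-div y = trans (to-hom _ _) (cong₂ H._·_ (f-inv c) (to∘from y))
      from-div : ∀ y → from (to c H.⁻¹ H.· y) ≡ c G.⁻¹ G.· from y
      from-div y = trans (cong from (sym (to-div y))) (from∘to _)

  induced : XS.Vtx → XS'.Vtx
  induced (XS.tv (XS.node i C p))      = XS'.tv (XS'.node i (image C) (image-coset i C p))
  induced (XS.cv x (XS.subnode i C p)) = XS'.cv (to x) (XS'.subnode i (image C) (image-coset (inject₁ i) C p))
  induced (XS.ev x y d)                = XS'.ev (to x) (to y) d

  induced-tree : ∀ w → T.IsTree w → T'.IsTree (induced w)
  induced-tree (XS.tv _)   _ = tt
  induced-tree (XS.cv _ _) _ = tt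

  induced-height : ∀ w → T'.height (induced w) ≡ T.height w
  induced-height (XS.tv _)     = refl
  induced-height (XS.cv _ _)   = refl
  induced-height (XS.ev _ _ _) = refl

  induced-below⁺ : ∀ w x y → T.Below w x y → T'.Below (induced w) (to x) (to y)
  induced-below⁺ (XS.tv _)   x y x∈ = ∈-preimage⁺ (subst (_∈ _) (sym (from∘to x)) x∈)
  induced-below⁺ (XS.cv _ _) x y (x≡x' , y∈) = cong to x≡x' , ∈-preimage⁺ (subst (_∈ _) (sym (from∘to y)) y∈)

  induced-below⁻ : ∀ w a b → T'.Below (induced w) a b → T.Below w (from a) (from b)
  induced-below⁻ (XS.tv _)    a b a∈ = ∈-preimage⁻ a∈
  induced-below⁻ (XS.cv x _)  a b (a≡tx , b∈) = trans (cong from a≡tx) (from∘to x) , ∈-preimage⁻ b∈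

  -- heights and leaf sets are preserved, hence so are tree edges ...
  induced-treeEdge : ∀ u v → T.IsTree u → T.IsTree v → XS.Edge u v → XS'.Edge (induced u) (induced v)
  induced-treeEdge u v tu tv E = T'.treeEdge⇐ (induced u) (induced v) (induced-tree u tu) (induced-tree v tv)
      (trans (induced-height u) (trans (proj₁ below) (cong suc (sym (induced-height v)))))
      (λ a b ab → subst₂ (T'.Below (induced u)) (to∘from a) (to∘from b)
                    (induced-below⁺ u _ _ (proj₂ below _ _ (induced-below⁻ v a b ab))))
    where below = T.treeEdge⇒ u v tu tv E

  -- ... and edges to the extra leaves
  induced-extraEdge : ∀ u {x y d} → T.IsTree u → XS.Edge u (XS.ev x y d) →
                      XS'.Edge (induced u) (XS'.ev (to x) (to y) d)
  induced-extraEdge u {x} {y} tu E =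
    T'.extraEdge⇐ (induced u) (induced-tree u tu) (trans (induced-height u) (proj₁ below))
                  (induced-below⁺ u x y (proj₂ below))
    where below = T.extraEdge⇒ u tu E

  induced-edge : ∀ u v → XS.Edge u v → XS'.Edge (induced u) (induced v)
  induced-edge (XS.tv a)    (XS.tv b)     E = induced-treeEdge (XS.tv a) (XS.tv b) tt tt E
  induced-edge (XS.tv a)    (XS.cv x b)   E = induced-treeEdge (XS.tv a) (XS.cv x b) tt tt E
  induced-edge (XS.cv x a)  (XS.cv x' b)  E = induced-treeEdge (XS.cv x a) (XS.cv x' b) tt tt E
  induced-edge (XS.tv a)    (XS.ev x y d) E = induced-extraEdge (XS.tv a) {x} {y} {d} tt E
  induced-edge (XS.cv x' a) (XS.ev x y d) E = induced-extraEdge (XS.cv x' a) {x} {y} {d} tt E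
  induced-edge (XS.ev x y left)  (XS.ev y' x' right) (y'≡y , x'≡x) = cong to y'≡y , cong to x'≡x
  induced-edge (XS.ev y x right) (XS.ev z y' equal)  (z≡xy , y'≡y) =
    trans (cong to z≡xy) (to-hom x y) , cong to y'≡y
  induced-edge (XS.cv x a) (XS.tv b) ()
  induced-edge (XS.ev x y left)  (XS.tv b) ()
  induced-edge (XS.ev x y right) (XS.tv b) ()
  induced-edge (XS.ev x y equal) (XS.tv b) ()
  induced-edge (XS.ev x y left)  (XS.cv _ b) ()
  induced-edge (XS.ev x y right) (XS.cv _ b) ()
  induced-edge (XS.ev x y equal) (XS.cv _ b) ()
  induced-edge (XS.ev x y left)  (XS.ev _ _ left) ()
  induced-edge (XS.ev x y left)  (XS.ev _ _ equal) ()
  induced-edge (XS.ev x y right) (XS.ev _ _ left) ()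
  induced-edge (XS.ev x y right) (XS.ev _ _ right) ()
  induced-edge (XS.ev x y equal) (XS.ev _ _ _) ()

  induced-adj : ∀ u v → XS.Adj u v → XS'.Adj (induced u) (induced v)
  induced-adj u v (inj₁ E) = inj₁ (induced-edge u v E)
  induced-adj u v (inj₂ E) = inj₂ (induced-edge v u E)

  induced-colour : ∀ v → XS'.color (induced v) ≡ XS.color v
  induced-colour (XS.tv _)         = refl
  induced-colour (XS.cv _ _)       = refl
  induced-colour (XS.ev _ _ left)  = refl
  induced-colour (XS.ev _ _ right) = refl
  induced-colour (XS.ev _ _ equal) = refl

module _ {G H : FinGroup} {m : ℕ} {S : CompositionSeries G m} {S' : CompositionSeries H m}
         (σ : InvertibleSeriesIso S S') where
  private module XS = X S
  open InvertibleSeriesIso σ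

  induced-inverse : ∀ v → Induced.induced (invert σ) (Induced.induced σ v) ≡ v
  induced-inverse (XS.tv (XS.node i C p)) =
    Geometry.tv-cong S refl (preimage-inverse {g = from} {h = to} C from∘to) _ p
  induced-inverse (XS.cv x (XS.subnode i C p)) =
    Geometry.cv-cong S (from∘to x) refl (preimage-inverse {g = from} {h = to} C from∘to) _ p
  induced-inverse (XS.ev x y d) = cong₂ (λ a b → XS.ev a b d) (from∘to x) (from∘to y)

module _ {G H : FinGroup} {m : ℕ} {S : CompositionSeries G m} {S' : CompositionSeries H m} where
  private
    module XS = X S
    module XS' = X S'
    module T' = Geometry S'

  -- X(φ) depends only on φ as a function: if φ and ψ agree, so do their inverses and images.
  module _ (σ τ : InvertibleSeriesIso S S')
           (to≗ : ∀ x → InvertibleSeriesIso.to σ x ≡ InvertibleSeriesIso.to τ x) where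
    private
      module σ = InvertibleSeriesIso σ
      module τ = InvertibleSeriesIso τ

    from≗ : ∀ y → σ.from y ≡ τ.from y
    from≗ y = begin
      σ.from y                  ≡⟨ τ.from∘to (σ.from y) ⟨
      τ.from (τ.to (σ.from y))  ≡⟨ cong τ.from (to≗ (σ.from y)) ⟨
      τ.from (σ.to (σ.from y))  ≡⟨ cong τ.from (σ.to∘from y) ⟩
      τ.from y                  ∎
      where open ≡-Reasoning

    induced-cong : ∀ v → Induced.induced σ v ≡ Induced.induced τ v
    induced-cong (XS.tv (XS.node i C p))      = T'.tv-cong refl (preimage-cong C from≗) _ _
    induced-cong (XS.cv x (XS.subnode i C p)) = T'.cv-cong (to≗ x) refl (preimage-cong C from≗) _ _
    induced-cong (XS.ev x y d)                = cong₂ (λ a b → XS'.ev a b d) (to≗ x) (to≗ y)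

  inducedGraphIso : InvertibleSeriesIso S S' → GraphIso S S'
  inducedGraphIso σ = record
    { fun = induced
    ; bij = inverse⇒bijective (record
        { inv = Induced.induced (invert σ) ; f∘inv = induced∘inverse ; inv∘f = induced-inverse σ })
    ; adj = λ u v → induced-adj u v ,
              λ a → subst₂ XS.Adj (induced-inverse σ u) (induced-inverse σ v)
                                  (Induced.induced-adj (invert σ) _ _ a)
    ; col = induced-colour }
    where
      open Induced σ
      -- invert (invert σ) has the same underlying map as σ
      induced∘inverse : ∀ v → induced (Induced.induced (invert σ) v) ≡ v
      induced∘inverse v =
        trans (induced-cong σ (invert (invert σ)) (λ _ → refl) _) (induced-inverse (invert σ) v)

module _ {G H : FinGroup} {m : ℕ} {S : CompositionSeries G m} {S' : CompositionSeries H m} where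

  inverseGraphIso : GraphIso S S' → GraphIso S' S
  inverseGraphIso g = record
    { fun = inv
    ; bij = inverse⇒bijective (record { inv = fun ; f∘inv = inv∘f ; inv∘f = f∘inv })
    ; adj = λ u v →
        (λ a → proj₂ (adj (inv u) (inv v)) (subst₂ (X.Adj S') (sym (f∘inv u)) (sym (f∘inv v)) a)) ,
        (λ a → subst₂ (X.Adj S') (f∘inv u) (f∘inv v) (proj₁ (adj (inv u) (inv v)) a))
    ; col = λ v → trans (sym (col (inv v))) (cong (X.color S') (f∘inv v)) }
    where
      open GraphIso g
      open TwoSidedInverse (bijective⇒inverse bij)

module GraphIsoFacts {G H : FinGroup} {m : ℕ} {S : CompositionSeries G m} {S' : CompositionSeries H m}
                     (g : GraphIso S S') where
  module XS = X S
  module XS' = X S'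
  module T = Geometry S
  module T' = Geometry S'

  f : XS.Vtx → XS'.Vtx
  f = GraphIso.fun g

  f⁻¹ : XS'.Vtx → XS.Vtx
  f⁻¹ = GraphIso.fun (inverseGraphIso g)

  open TwoSidedInverse (bijective⇒inverse (GraphIso.bij g)) public
    using () renaming (f∘inv to f∘f⁻¹; inv∘f to f⁻¹∘f)

  f-adj : ∀ u v → XS.Adj u v → XS'.Adj (f u) (f v)
  f-adj u v = proj₁ (GraphIso.adj g u v)

  f-tree : ∀ w → T.IsTree w → T'.IsTree (f w)
  f-tree w tw = T'.colour-tree (f w) (subst IsTreeColour (sym (GraphIso.col g w)) (T.tree-colour w tw))

  private
    f-extra-shape : ∀ x y d →
                    f (XS.ev x y d) ≡ XS'.ev (T'.evCopy (f (XS.ev x y d))) (T'.evLeaf (f (XS.ev x y d))) d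
    f-extra-shape x y d =
      T'.extra-shape (f (XS.ev x y d)) d (trans (GraphIso.col g (XS.ev x y d)) (T.extra-colour x y d))

  f-extraEdge : ∀ w {x y d} → T.IsTree w → XS.Edge w (XS.ev x y d) →
                T'.height (f w) ≡ 0 × T'.Below (f w) (T'.evCopy (f (XS.ev x y d))) (T'.evLeaf (f (XS.ev x y d)))
  f-extraEdge w {x} {y} {d} tw E = T'.extraEdge⇒ (f w) (f-tree w tw)
    (T'.extraAdj⇒edge (f w) (f-tree w tw) (subst (XS'.Adj (f w)) (f-extra-shape x y d) (f-adj w _ (inj₁ E))))

  copyMap leafMap : Fin (FinGroup.n G) → Fin (FinGroup.n G) → Fin (FinGroup.n H)
  copyMap x y = T'.evCopy (f (XS.ev x y left))
  leafMap x y = T'.evLeaf (f (XS.ev x y left))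

  -- All three extra leaves at y^(x) go to extra leaves at the same leaf of
  -- X(S'), since the image of y^(x) has a single leaf below it.
  f-extra : ∀ x y d → f (XS.ev x y d) ≡ XS'.ev (copyMap x y) (leafMap x y) d
  f-extra x y d with T.leaf x y
  ... | w , tw , hw≡0 , below =
    trans (f-extra-shape x y d) (cong₂ (λ a b → XS'.ev a b d) (proj₁ same) (proj₂ same))
    where
      at : ∀ d' → T'.height (f w) ≡ 0 ×
                  T'.Below (f w) (T'.evCopy (f (XS.ev x y d'))) (T'.evLeaf (f (XS.ev x y d')))
      at d' = f-extraEdge w tw (T.extraEdge⇐ w tw hw≡0 below)
      same : T'.evCopy (f (XS.ev x y d)) ≡ copyMap x y × T'.evLeaf (f (XS.ev x y d)) ≡ leafMap x y
      same = T'.below₀-unique (f w) (f-tree w tw) (proj₁ (at d)) (proj₂ (at d)) (proj₂ (at left))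

  f-height₀ : ∀ w {x y} → T.IsTree w → T.height w ≡ 0 → T.Below w x y →
              T'.height (f w) ≡ 0 × T'.Below (f w) (copyMap x y) (leafMap x y)
  f-height₀ w tw hw≡0 below = f-extraEdge w tw (T.extraEdge⇐ w {d = left} tw hw≡0 below)

-- By
-- induction on the height: a vertex w of height h+1 has a child u of height h,
-- and f w is adjacent to f u, of height h.  If f w lay below f u, f w would
-- have height h-1, and by induction for f⁻¹ so would w = f⁻¹(f w).
HeightPreserved : ℕ → Set
HeightPreserved h = ∀ {G H : FinGroup} {m : ℕ} {S : CompositionSeries G m} {S' : CompositionSeries H m}
  (g : GraphIso S S') w → Geometry.IsTree S w → Geometry.height S w ≡ h →
  Geometry.height S' (GraphIso.fun g w) ≡ h

height-preserved₀ : HeightPreserved 0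
height-preserved₀ {S = S} g w tw hw≡0 =
  proj₁ (f-height₀ w tw hw≡0 (proj₂ (proj₂ (Geometry.below-nonempty S w tw))))
  where open GraphIsoFacts g

height-preserved-suc : ∀ h → HeightPreserved h → HeightPreserved (ℕ.pred h) → HeightPreserved (suc h)
height-preserved-suc h IH IH-pred {S = S} g w tw hw≡h+1 with Geometry.below-nonempty S w tw
... | _ , _ , below with Geometry.child S w tw hw≡h+1 below
... | u , tu , w→u , _ = orient (f-adj w u (inj₁ w→u))
  where
    open GraphIsoFacts g
    hfu≡h : T'.height (f u) ≡ h
    hfu≡h = IH g u tu (ℕP.suc-injective (trans (sym (proj₁ (T.treeEdge⇒ w u tw tu w→u))) hw≡h+1))

    orient : XS'.Adj (f w) (f u) → T'.height (f w) ≡ suc h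
    orient (inj₁ fw→fu) =
      trans (proj₁ (T'.treeEdge⇒ (f w) (f u) (f-tree w tw) (f-tree u tu) fw→fu)) (cong suc hfu≡h)
    orient (inj₂ fu→fw) =
      ⊥-elim (n≢2+n (T'.height (f w)) (trans (sym hw≡hfw) (trans hw≡h+1 (cong suc h≡hfw+1))))
      where
        h≡hfw+1 : h ≡ suc (T'.height (f w))
        h≡hfw+1 = trans (sym hfu≡h) (proj₁ (T'.treeEdge⇒ (f u) (f w) (f-tree u tu) (f-tree w tw) fu→fw))
        hw≡hfw : T.height w ≡ T'.height (f w)
        hw≡hfw = subst (λ v → T.height v ≡ T'.height (f w)) (f⁻¹∘f w)
                   (trans (IH-pred (inverseGraphIso g) (f w) (f-tree w tw) (cong ℕ.pred (sym h≡hfw+1)))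
                          (cong ℕ.pred h≡hfw+1))

height-preserved : ∀ h → HeightPreserved h
height-preserved h = proj₁ (up-to h)
  where
    up-to : ∀ h → HeightPreserved h × HeightPreserved (ℕ.pred h)
    up-to zero    = height-preserved₀ , height-preserved₀
    up-to (suc h) = height-preserved-suc h (proj₁ (up-to h)) (proj₂ (up-to h)) , proj₁ (up-to h)

module Recovery {G H : FinGroup} {m : ℕ} {S : CompositionSeries G m} {S' : CompositionSeries H m}
                (g : GraphIso S S') where
  open GraphIsoFacts g public
  private
    module G = GroupFacts G
    module H = GroupFacts H
    module CS = CompositionSeries S
    module CS' = CompositionSeries S'

  f-height : ∀ w → T.IsTree w → T'.height (f w) ≡ T.height w
  f-height w tw = height-preserved (T.height w) g w tw refl

  -- f maps the leaves below w to leaves below f w: descend to a height-0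
  -- vertex along a path of tree edges, which f preserves with their direction.
  f-below : ∀ w → T.IsTree w → ∀ {x y} → T.Below w x y → T'.Below (f w) (copyMap x y) (leafMap x y)
  f-below w tw = below-at (T.height w) w tw refl
    where
      below-at : ∀ h w → T.IsTree w → T.height w ≡ h → ∀ {x y} → T.Below w x y →
                 T'.Below (f w) (copyMap x y) (leafMap x y)
      below-at zero    w tw hw≡0 below = proj₂ (f-height₀ w tw hw≡0 below)
      below-at (suc h) w tw hw≡h+1 below with T.child w tw hw≡h+1 below
      ... | u , tu , w→u , below-u =
        proj₂ (T'.treeEdge⇒ (f w) (f u) (f-tree w tw) (f-tree u tu) fw→fu) _ _ (below-at h u tu hu≡h below-u)
        where
          hu≡h : T.height u ≡ h
          hu≡h = ℕP.suc-injective (trans (sym (proj₁ (T.treeEdge⇒ w u tw tu w→u))) hw≡h+1)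
          fw→fu : XS'.Edge (f w) (f u)
          fw→fu = T'.treeAdj⇒edge (f w) (f u) (f-tree w tw) (f-tree u tu) (f-adj w u (inj₁ w→u))
                    (trans (f-height w tw) (trans hw≡h+1 (cong suc (sym (trans (f-height u tu) hu≡h)))))

  α : Fin G.n → Fin H.n
  α x = copyMap x G.e

  -- The copy index depends only on the copy: all leaves y^(x) lie below the
  -- leaf x of T_S (height m), whose image is a vertex of height m.
  copyMap≡α : ∀ x y → copyMap x y ≡ α x
  copyMap≡α x y = T'.belowₘ-copy (f leaf-x) (f-tree leaf-x tt) (trans (f-height leaf-x tt) (ℕP.+-identityʳ m))
                    (f-below leaf-x tt x∈) (f-below leaf-x tt x∈)
    where
      leaf-x : XS.Vtx
      leaf-x = XS.tv (XS.node Fin.zero (T.coset Fin.zero x) (T.coset-isCoset Fin.zero x))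
      x∈ : x ∈ T.coset Fin.zero x
      x∈ = T.∈-coset Fin.zero x

  -- The edge y_←^(x) — x_→^(y) identifies the leaf label of f(y_←^(x)).
  leafMap≡α : ∀ x y → leafMap x y ≡ α y
  leafMap≡α x y = trans (sym (swapped (subst₂ XS'.Adj (f-extra x y left) (f-extra y x right)
                                          (f-adj _ _ (inj₁ (refl , refl))))))
                        (copyMap≡α y x)
    where
      swapped : ∀ {a b c d} → XS'.Adj (XS'.ev a b left) (XS'.ev c d right) → c ≡ b
      swapped (inj₁ (c≡b , _)) = c≡b
      swapped (inj₂ ())

  f-extra-α : ∀ x y d → f (XS.ev x y d) ≡ XS'.ev (α x) (α y) d
  f-extra-α x y d = trans (f-extra x y d) (cong₂ (λ a b → XS'.ev a b d) (copyMap≡α x y) (leafMap≡α x y))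

  f-below-α : ∀ w → T.IsTree w → ∀ {x y} → T.Below w x y → T'.Below (f w) (α x) (α y)
  f-below-α w tw {x} {y} below = subst₂ (T'.Below (f w)) (copyMap≡α x y) (leafMap≡α x y) (f-below w tw below)

  -- The edge x_→^(y) — y_=^(xy) makes α a homomorphism.
  α-hom : ∀ x y → α (x G.· y) ≡ α x H.· α y
  α-hom x y = product (subst₂ XS'.Adj (f-extra-α y x right) (f-extra-α (x G.· y) y equal)
                        (f-adj _ _ (inj₁ (refl , refl))))
    where
      product : ∀ {a b c d} → XS'.Adj (XS'.ev a b right) (XS'.ev c d equal) → c ≡ b H.· a
      product (inj₁ (c≡ba , _)) = c≡ba
      product (inj₂ ())

  -- α[Gᵢ] ⊆ Hᵢ: the node Gᵢ of T_S, of height m+i, has the leaves e^(x) with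
  -- x ∈ Gᵢ below it; its image has height m+i and the leaf e^(e) below it.
  α-series : ∀ i x → x ∈ CS.grp i → α x ∈ CS'.grp i
  α-series i x x∈ = subst (_∈ CS'.grp i) (copyMap≡α x x)
    (T'.below-grp (f Gᵢ) i (f-tree Gᵢ tt) (f-height Gᵢ tt) (f-below Gᵢ tt e∈) (f-below Gᵢ tt x∈Gᵢ) e'∈)
    where
      Gᵢ : XS.Vtx
      Gᵢ = XS.tv (XS.node i (T.coset i G.e) (T.coset-isCoset i G.e))
      e∈ : G.e ∈ T.coset i G.e
      e∈ = T.∈-coset i G.e
      x∈Gᵢ : x ∈ T.coset i G.e
      x∈Gᵢ = ∈-preimage⁺ (subst (_∈ CS.grp i) (sym (G.e-div x)) x∈)
      e'∈ : copyMap G.e G.e ∈ CS'.grp i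
      e'∈ = subst (_∈ CS'.grp i) (sym (trans (copyMap≡α G.e G.e) (HomomorphismFacts.f-e {G} {H} α α-hom)))
              (IsSubgroup.e∈ (CS'.subgroup i))

module _ {G H : FinGroup} {m : ℕ} {S : CompositionSeries G m} {S' : CompositionSeries H m}
         (g : GraphIso S S') where
  private
    module R = Recovery g
    module R⁻¹ = Recovery (inverseGraphIso g)
    module XS = X S
    module XS' = X S'

  -- The map recovered from f⁻¹ inverts α; compare f and f⁻¹ on the vertices x_←^(x).
  α∘α⁻¹ : ∀ y → R.α (R⁻¹.α y) ≡ y
  α∘α⁻¹ y = cong R.T'.evCopy (begin
    XS'.ev (R.α (R⁻¹.α y)) (R.α (R⁻¹.α y)) left  ≡⟨ R.f-extra-α (R⁻¹.α y) (R⁻¹.α y) left ⟨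
    R.f (XS.ev (R⁻¹.α y) (R⁻¹.α y) left)         ≡⟨ cong R.f (R⁻¹.f-extra-α y y left) ⟨
    R.f (R.f⁻¹ (XS'.ev y y left))                ≡⟨ R.f∘f⁻¹ _ ⟩
    XS'.ev y y left                              ∎)
    where open ≡-Reasoning

  α⁻¹∘α : ∀ x → R⁻¹.α (R.α x) ≡ x
  α⁻¹∘α x = cong R.T.evCopy (begin
    XS.ev (R⁻¹.α (R.α x)) (R⁻¹.α (R.α x)) left  ≡⟨ R⁻¹.f-extra-α (R.α x) (R.α x) left ⟨
    R.f⁻¹ (XS'.ev (R.α x) (R.α x) left)          ≡⟨ cong R.f⁻¹ (R.f-extra-α x x left) ⟨
    R.f⁻¹ (R.f (XS.ev x x left))                 ≡⟨ R.f⁻¹∘f _ ⟩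
    XS.ev x x left                               ∎)
    where open ≡-Reasoning

  seriesOfGraph : InvertibleSeriesIso S S'
  seriesOfGraph = record
    { to = R.α ; from = R⁻¹.α ; to∘from = α∘α⁻¹ ; from∘to = α⁻¹∘α
    ; to-hom = R.α-hom ; to-series = R.α-series ; from-series = R⁻¹.α-series }

  -- On tree vertices X(α) agrees with f, as X(α)(w) and f(w) have the same
  -- height and the same leaves below them.
  induced-on-tree : ∀ w → R.T.IsTree w → Induced.induced seriesOfGraph w ≡ R.f w
  induced-on-tree w tw = R.T'.tree-ext (induced w) (R.f w) (induced-tree w tw) (R.f-tree w tw)
      (trans (induced-height w) (sym (R.f-height w tw)))
      (λ a b below → subst₂ (R.T'.Below (R.f w)) (α∘α⁻¹ a) (α∘α⁻¹ b)
                       (R.f-below-α w tw (induced-below⁻ w a b below)))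
      (λ a b below → subst₂ (R.T'.Below (induced w)) (α∘α⁻¹ a) (α∘α⁻¹ b)
                       (induced-below⁺ w _ _ (pull-back a b below)))
    where
      open Induced seriesOfGraph
      -- leaves below f w come from leaves below w = f⁻¹ (f w)
      pull-back : ∀ a b → R.T'.Below (R.f w) a b → R.T.Below w (R⁻¹.α a) (R⁻¹.α b)
      pull-back a b below = subst (λ v → R.T.Below v (R⁻¹.α a) (R⁻¹.α b)) (R.f⁻¹∘f w)
                              (R⁻¹.f-below-α (R.f w) (R.f-tree w tw) below)

  induced-seriesOfGraph : ∀ v → Induced.induced seriesOfGraph v ≡ R.f v
  induced-seriesOfGraph (XS.ev x y d) = sym (R.f-extra-α x y d)
  induced-seriesOfGraph (XS.tv a)     = induced-on-tree (XS.tv a) tt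
  induced-seriesOfGraph (XS.cv x a)   = induced-on-tree (XS.cv x a) tt

theorem9 : {G H : FinGroup} {m : ℕ}
           (S : CompositionSeries G m) (S' : CompositionSeries H m) →
           Bijection (IsoSeriesSetoid S S') (IsoGraphSetoid S S')
theorem9 S S' = record
  { to = λ φ → inducedGraphIso (withInverse φ)
  ; cong = λ {φ} {ψ} φ≈ψ → induced-cong (withInverse φ) (withInverse ψ) φ≈ψ
  ; bijective = (λ {φ} {ψ} → injective {φ} {ψ}) , surjective }
  where
    -- φ(x) is the copy index of X(φ)(x_←^(x))
    injective : ∀ {φ ψ} → (∀ v → Induced.induced (withInverse φ) v ≡ Induced.induced (withInverse ψ) v) →
                ∀ x → GroupIso.fun (SeriesIso.iso φ) x ≡ GroupIso.fun (SeriesIso.iso ψ) x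
    injective X[φ]≈X[ψ] x = cong (Geometry.evCopy S') (X[φ]≈X[ψ] (X.ev x x left))

    surjective : ∀ f → ∃ λ φ → ∀ {ψ} →
                 (∀ x → GroupIso.fun (SeriesIso.iso ψ) x ≡ GroupIso.fun (SeriesIso.iso φ) x) →
                 ∀ v → Induced.induced (withInverse ψ) v ≡ GraphIso.fun f v
    surjective f = forgetInverse (seriesOfGraph f) , λ {ψ} ψ≈α v →
      trans (induced-cong (withInverse ψ) (seriesOfGraph f) ψ≈α v) (induced-seriesOfGraph f v)
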